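{- Let $G$ be a finite connected graph and let $R(G)$ be its bridge tree, with vertex weights as described below. If $R(G)$ has no edge center but has an atomic vertex center, then no spanning tree $S$ of $G$ is 0-splittable; that is, there is no edge $e$ of $S$ such that the two components of $S-e$ have the same number of vertices.
   Context: The bridge tree (bridge-block decomposition) $R(G)$ of a connected graph $G$ is obtained by contracting each 2-edge-connected component of $G$ to a single vertex (a region), weighted by the number of vertices of $G$ contracted into it; its edges are the bridges of $G$. A region is atomic if it consists of a single vertex of $G$. For a vertex-weighted tree with total weight $W$, a center is an edge or a vertex whose removal separates the tree into subtrees each of total weight at most $W/2$ (edge center or vertex center respectively). -}

module Defs where

open import Data.Nat using (ℕ; _*_; _≤_; _+_)
open import Data.Fin using (Fin)
open import Data.Fin.Subset using (Subset; _∈_; ∣_∣)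
open import Data.Bool using (Bool; true)
open import Data.List using (List; []; _∷_; length; _∷ʳ_)
open import Data.List.Relation.Unary.Unique.Propositional using (Unique)
open import Data.Product using (Σ; ∃; ∃-syntax; _×_; _,_)
open import Data.Sum using (_⊎_)
open import Data.Unit using (⊤)
open import Relation.Nullary using (¬_)
open import Relation.Binary.PropositionalEquality using (_≡_)

record Graph (n : ℕ) : Set where
  field
    adj   : Fin n → Fin n → Bool
    sym   : ∀ x y → adj x y ≡ adj y x
    irrfl : ∀ x → ¬ (adj x x ≡ true)
open Graph public

Edge : ∀ {n} → Graph n → Fin n → Fin n → Set
Edge G x y = adj G x y ≡ true

data Reach {n} (E : Fin n → Fin n → Set) : Fin n → Fin n → Set where
  here : ∀ {x} → Reach E x x
  step : ∀ {x y z} → E x y → Reach E y z → Reach E x z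

Connected : ∀ {n} → Graph n → Set
Connected G = ∀ x y → Reach (Edge G) x y

EdgeMinus : ∀ {n} → Graph n → Fin n → Fin n → Fin n → Fin n → Set
EdgeMinus G u v x y = Edge G x y × ¬ (x ≡ u × y ≡ v) × ¬ (x ≡ v × y ≡ u)

Bridge : ∀ {n} → Graph n → Fin n → Fin n → Set
Bridge G u v = Edge G u v × ¬ Reach (EdgeMinus G u v) u v

-- Regions (2-edge-connected components) are the connected components of
-- G minus all its bridges; a region is represented by any of its vertices,
-- so a tree vertex is a class of  SameRegion G.  The weight of a set of
-- regions is the number of vertices of G contracted into them.

SameRegion : ∀ {n} → Graph n → Fin n → Fin n → Set
SameRegion G = Reach (λ x y → Edge G x y × ¬ Bridge G x y)

AtomicRegion : ∀ {n} → Graph n → Fin n → Set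
AtomicRegion G c = ∀ y → SameRegion G c y → y ≡ c

-- a step of R(G) between (representatives of) regions: either staying in
-- the same region, or crossing an edge of R(G), i.e. a bridge of G
TreeStep : ∀ {n} → Graph n → Fin n → Fin n → Set
TreeStep G a b =
  SameRegion G a b ⊎
  (∃[ p ] ∃[ q ] SameRegion G a p × Bridge G p q × SameRegion G q b)

TreeStepMinusRegion : ∀ {n} → Graph n → Fin n → Fin n → Fin n → Set
TreeStepMinusRegion G c a b =
  TreeStep G a b × ¬ SameRegion G c a × ¬ SameRegion G c b

TreeStepMinusEdge : ∀ {n} → Graph n → Fin n → Fin n → Fin n → Fin n → Set
TreeStepMinusEdge G u w a b =
  SameRegion G a b ⊎
  (∃[ p ] ∃[ q ] SameRegion G a p × Bridge G p q × SameRegion G q b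
     × ¬ (p ≡ u × q ≡ w) × ¬ (p ≡ w × q ≡ u))

-- "the component of R(G) − X containing the region of x has weight ≤ W/2"
-- (W = n): every set of G-vertices lying in regions of that component has
-- at most n/2 elements.
LightComponent : ∀ {n} → (Fin n → Fin n → Set) → Fin n → Set
LightComponent {n} E x =
  ∀ (S : Subset n) → (∀ y → y ∈ S → Reach E x y) → 2 * ∣ S ∣ ≤ n

VertexCenter : ∀ {n} → Graph n → Fin n → Set
VertexCenter G c =
  ∀ x → ¬ SameRegion G c x → LightComponent (TreeStepMinusRegion G c) x

EdgeCenter : ∀ {n} → Graph n → Fin n → Fin n → Set
EdgeCenter G u w =
  Bridge G u w × (∀ x → LightComponent (TreeStepMinusEdge G u w) x)

HasEdgeCenter : ∀ {n} → Graph n → Set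
HasEdgeCenter G = ∃[ u ] ∃[ w ] EdgeCenter G u w

HasAtomicVertexCenter : ∀ {n} → Graph n → Set
HasAtomicVertexCenter G = ∃[ c ] AtomicRegion G c × VertexCenter G c

Chain : ∀ {n} → (Fin n → Fin n → Set) → List (Fin n) → Set
Chain E []           = ⊤
Chain E (x ∷ [])     = ⊤
Chain E (x ∷ y ∷ xs) = E x y × Chain E (y ∷ xs)

HasCycle : ∀ {n} → Graph n → Set
HasCycle G = ∃[ v ] ∃[ ys ] ∃[ w ]
  (1 ≤ length ys × Unique ((v ∷ ys) ∷ʳ w)
   × Chain (Edge G) ((v ∷ ys) ∷ʳ w) × Edge G w v)

IsTree : ∀ {n} → Graph n → Set
IsTree T = Connected T × ¬ HasCycle T

IsSpanningTree : ∀ {n} → Graph n → Graph n → Set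
IsSpanningTree G S = (∀ x y → Edge S x y → Edge G x y) × IsTree S

ZeroSplittable : ∀ {n} → Graph n → Set
ZeroSplittable {n} S = ∃[ u ] ∃[ w ] Edge S u w ×
  ∃[ A ] ∃[ B ]
    ((∀ y → y ∈ A → Reach (EdgeMinus S u w) u y) ×
     (∀ y → Reach (EdgeMinus S u w) u y → y ∈ A) ×
     (∀ y → y ∈ B → Reach (EdgeMinus S u w) w y) ×
     (∀ y → Reach (EdgeMinus S u w) w y → y ∈ B) ×
     ∣ A ∣ ≡ ∣ B ∣)

-- Let c be the atomic vertex center and let S − uw split into two halves
-- A and B of equal size; every vertex lies in A or in B, so each half is
-- at least as large as its complement, and c misses one of them, say D
-- (it cannot lie in both, as uw is a bridge of the tree S).  D is
-- connected in G − c, so it hangs off a neighbour p of c, and cp is a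
-- bridge because the region of c is the single vertex c.  Then cp is an
-- edge center of R(G): the side of c is disjoint from the heavy set D, and
-- the side of p avoids c, so it is light because c is a vertex center.
-- Deciding which edges are bridges is classical, but the goal is a
-- negation, so excluded middle is available under double negation.
module Submission where

open import Defs
open import Data.Nat using (ℕ; _≤_; _+_; _*_; _∸_; z≤n; s≤s)
open import Data.Nat.Properties using (≤-trans; +-mono-≤; +-identityʳ; m∸n+n≡m; module ≤-Reasoning)
open import Data.Fin using (Fin; _≟_)
open import Data.Fin.Properties using (sequence)
open import Data.Fin.Subset using (Subset; ∣_∣; ∁; _∈_; _∉_; _⊆_)
open import Data.Fin.Subset.Properties using (_∈?_; p⊆q⇒∣p∣≤∣q∣; ∣∁p∣≡n∸∣p∣; ∣p∣≤n; x∉p⇒x∈∁p; x∈∁p⇒x∉p)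
open import Data.List using (List; []; _∷_; _∷ʳ_)
open import Data.List.Relation.Unary.Any using (here; there)
open import Data.List.Relation.Unary.All using ([])
open import Data.List.Relation.Unary.All.Properties using (¬Any⇒All¬)
open import Data.List.Relation.Unary.AllPairs using ([]; _∷_)
open import Data.List.Relation.Unary.Unique.Propositional using (Unique)
import Data.List.Membership.DecPropositional as DecMembership
open import Data.Product using (∃-syntax; _×_; _,_; proj₁; proj₂)
open import Data.Sum as Sum using (_⊎_; inj₁; inj₂)
open import Data.Unit using (tt)
open import Data.Empty using (⊥; ⊥-elim)
open import Effect.Monad using (RawMonad)
open import Function using (_∘_; id)
open import Relation.Nullary using (¬_; yes; no)
open import Relation.Nullary.Decidable using (¬¬-excluded-middle)
open import Relation.Nullary.Negation using (¬¬-Monad)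
open import Relation.Binary.Definitions using (Decidable)
open import Relation.Binary.PropositionalEquality using (_≡_; _≢_; refl; cong; subst; trans) renaming (sym to ≡-sym)

private
  variable
    n : ℕ

¬¬-decidable : (R : Fin n → Fin n → Set) → ¬ ¬ Decidable R
¬¬-decidable R = sequence ¬¬-applicative λ a → sequence ¬¬-applicative λ b → ¬¬-excluded-middle
  where open RawMonad ¬¬-Monad using () renaming (rawApplicative to ¬¬-applicative)

equal-cover⇒∣∁p∣≤∣p∣ : (A B : Subset n) → (∀ y → y ∈ A ⊎ y ∈ B) → ∣ A ∣ ≡ ∣ B ∣ → ∣ ∁ A ∣ ≤ ∣ A ∣
equal-cover⇒∣∁p∣≤∣p∣ A B cover ∣A∣≡∣B∣ = begin
  ∣ ∁ A ∣ ≤⟨ p⊆q⇒∣p∣≤∣q∣ ∁A⊆B ⟩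
  ∣ B ∣   ≡⟨ ≡-sym ∣A∣≡∣B∣ ⟩
  ∣ A ∣   ∎
  where
  open ≤-Reasoning
  ∁A⊆B : ∁ A ⊆ B
  ∁A⊆B {y} y∈∁A = Sum.[ ⊥-elim ∘ x∈∁p⇒x∉p y∈∁A , id ] (cover y)

⊆∁-heavy⇒light : (T D : Subset n) → T ⊆ ∁ D → ∣ ∁ D ∣ ≤ ∣ D ∣ → 2 * ∣ T ∣ ≤ n
⊆∁-heavy⇒light {n} T D T⊆∁D heavy = begin
  2 * ∣ T ∣             ≡⟨ cong (∣ T ∣ +_) (+-identityʳ ∣ T ∣) ⟩
  ∣ T ∣ + ∣ T ∣         ≤⟨ +-mono-≤ ∣T∣≤∣∁D∣ (≤-trans ∣T∣≤∣∁D∣ heavy) ⟩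
  ∣ ∁ D ∣ + ∣ D ∣       ≡⟨ cong (_+ ∣ D ∣) (∣∁p∣≡n∸∣p∣ D) ⟩
  n ∸ ∣ D ∣ + ∣ D ∣     ≡⟨ m∸n+n≡m (∣p∣≤n D) ⟩
  n                     ∎
  where
  open ≤-Reasoning
  ∣T∣≤∣∁D∣ : ∣ T ∣ ≤ ∣ ∁ D ∣
  ∣T∣≤∣∁D∣ = p⊆q⇒∣p∣≤∣q∣ T⊆∁D

module _ {E F : Fin n → Fin n → Set} where

  reach-map : (∀ {a b} → E a b → F a b) → ∀ {x y} → Reach E x y → Reach F x y
  reach-map f here       = here
  reach-map f (step e r) = step (f e) (reach-map f r)

module _ {E : Fin n → Fin n → Set} where

  reach-trans : ∀ {x y z} → Reach E x y → Reach E y z → Reach E x z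
  reach-trans here       r′ = r′
  reach-trans (step e r) r′ = step e (reach-trans r r′)

  reach-sym : (∀ {a b} → E a b → E b a) → ∀ {x y} → Reach E x y → Reach E y x
  reach-sym flip here       = here
  reach-sym flip (step e r) = reach-trans (reach-sym flip r) (step (flip e) here)

  reach-concatMap : ∀ {F} → (∀ {a b} → F a b → Reach E a b) → ∀ {x y} → Reach F x y → Reach E x y
  reach-concatMap f here       = here
  reach-concatMap f (step e r) = reach-trans (f e) (reach-concatMap f r)

Avoiding : Fin n → (Fin n → Fin n → Set) → Fin n → Fin n → Set
Avoiding c E a b = E a b × a ≢ c × b ≢ c

IsComponent : (Fin n → Fin n → Set) → Fin n → Subset n → Set
IsComponent E r D = (∀ y → y ∈ D → Reach E r y) × (∀ y → Reach E r y → y ∈ D)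

module _ {E : Fin n → Fin n → Set} {c : Fin n} where

  reach-avoiding : ∀ {x y} → Reach E x y → ¬ Reach E x c → Reach (Avoiding c E) x y
  reach-avoiding here _ = here
  reach-avoiding (step e r) x↛c =
    step (e , x↛c ∘ (λ { refl → here }) , x↛c ∘ (λ { refl → step e here }))
         (reach-avoiding r (x↛c ∘ step e))

  last-exit : ∀ {x r} → r ≢ c → Reach E x r →
             (x ≢ c × Reach (Avoiding c E) x r) ⊎ (∃[ p ] E c p × Reach (Avoiding c E) p r)
  last-exit r≢c here = inj₁ (r≢c , here)
  last-exit r≢c (step {x} {y} e r) with last-exit r≢c r
  ... | inj₂ exit = inj₂ exit
  ... | inj₁ (y≢c , y⇝r) with x ≟ c
  ...   | yes refl = inj₂ (y , e , y⇝r)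
  ...   | no x≢c   = inj₁ (x≢c , step (e , x≢c , y≢c) y⇝r)

data Path (E : Fin n → Fin n → Set) : Fin n → Fin n → List (Fin n) → Set where
  stop : ∀ {x} → Path E x x []
  _◅_  : ∀ {x y z ys} → E x y → Path E y z ys → Path E x z (y ∷ ys)

module _ {E F : Fin n → Fin n → Set} where

  path-map : (∀ {a b} → E a b → F a b) → ∀ {x z ys} → Path E x z ys → Path F x z ys
  path-map f stop     = stop
  path-map f (e ◅ π) = f e ◅ path-map f π

module _ {E : Fin n → Fin n → Set} where

  open DecMembership (_≟_ {n}) using () renaming (_∈_ to _∈ₗ_; _∈?_ to _∈ₗ?_)

  path-chain : ∀ {x z ys} → Path E x z ys → Chain E (x ∷ ys)
  path-chain stop             = tt
  path-chain (e ◅ stop)       = e , tt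
  path-chain (e ◅ (e′ ◅ π)) = e , path-chain (e′ ◅ π)

  path-last : ∀ {x z y ys} → Path E x z (y ∷ ys) → ∃[ mid ] y ∷ ys ≡ mid ∷ʳ z
  path-last (e ◅ stop)       = [] , refl
  path-last {y = y} (e ◅ (e′ ◅ π)) with path-last (e′ ◅ π)
  ... | mid , eq = y ∷ mid , cong (y ∷_) eq

  path-suffix : ∀ {x y z ys} → Path E y z ys → Unique (y ∷ ys) → x ∈ₗ y ∷ ys →
                ∃[ ys′ ] Path E x z ys′ × Unique (x ∷ ys′)
  path-suffix π       unique       (here refl) = _ , π , unique
  path-suffix (e ◅ π) (_ ∷ unique) (there x∈ys) = path-suffix π unique x∈ys

  reach⇒simple-path : ∀ {x z} → Reach E x z → ∃[ ys ] Path E x z ys × Unique (x ∷ ys)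
  reach⇒simple-path here = [] , stop , [] ∷ []
  reach⇒simple-path (step {x} {y} e r) with reach⇒simple-path r
  ... | ys , π , unique with x ∈ₗ? y ∷ ys
  ...   | yes x∈ys = path-suffix π unique x∈ys
  ...   | no x∉ys  = y ∷ ys , e ◅ π , ¬Any⇒All¬ _ x∉ys ∷ unique

module _ (G : Graph n) where

  edge-sym : ∀ {a b} → Edge G a b → Edge G b a
  edge-sym {a} {b} e = trans (sym G b a) e

  edgeMinus-sym : ∀ {u w a b} → EdgeMinus G u w a b → EdgeMinus G u w b a
  edgeMinus-sym (e , ≢uw , ≢wu) = edge-sym e , (λ (b≡u , a≡w) → ≢wu (a≡w , b≡u)) , (λ (b≡w , a≡u) → ≢uw (a≡u , b≡w))

  bridge-sym : ∀ {u w} → Bridge G u w → Bridge G w u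
  bridge-sym (e , u↛w) =
    edge-sym e , λ w⇝u → u↛w (reach-sym edgeMinus-sym (reach-map (λ (e , ≢wu , ≢uw) → e , ≢uw , ≢wu) w⇝u))

  reach-split : ∀ {u w y} → Reach (Edge G) y u → Reach (EdgeMinus G u w) u y ⊎ Reach (EdgeMinus G u w) w y
  reach-split here = inj₁ here
  reach-split {u} {w} (step {y} {y′} e r) with y ≟ u | y ≟ w
  ... | yes refl | _        = inj₁ here
  ... | no _     | yes refl = inj₂ here
  ... | no y≢u   | no y≢w   = Sum.map extend extend (reach-split r)
    where
    extend : ∀ {z} → Reach (EdgeMinus G u w) z y′ → Reach (EdgeMinus G u w) z y
    extend z⇝y′ = reach-trans z⇝y′ (step (edge-sym e , y≢w ∘ proj₂ , y≢u ∘ proj₂) here)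

  bridge-sides-disjoint : ∀ {u w y} → Bridge G u w →
                          Reach (EdgeMinus G u w) u y → Reach (EdgeMinus G u w) w y → ⊥
  bridge-sides-disjoint (_ , u↛w) u⇝y w⇝y = u↛w (reach-trans u⇝y (reach-sym edgeMinus-sym w⇝y))

  simple-detour⇒cycle : ∀ {u w ys} → Edge G u w → Path (EdgeMinus G u w) u w ys → Unique (u ∷ ys) → HasCycle G
  simple-detour⇒cycle u–w stop _ = ⊥-elim (irrfl G _ u–w)
  simple-detour⇒cycle u–w ((_ , ≢uw , _) ◅ stop) _ = ⊥-elim (≢uw (refl , refl))
  simple-detour⇒cycle {u} {w} u–w π@(_ ◅ (_ ◅ _)) unique with path-last π
  ... | m ∷ ms , eq =
    u , m ∷ ms , w , s≤s z≤n ,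
    subst (λ zs → Unique (u ∷ zs)) eq unique ,
    subst (λ zs → Chain (Edge G) (u ∷ zs)) eq (path-chain (path-map proj₁ π)) ,
    edge-sym u–w

  acyclic-edge⇒bridge : ¬ HasCycle G → ∀ {u w} → Edge G u w → Bridge G u w
  acyclic-edge⇒bridge acyclic u–w = u–w , λ u⇝w →
    let _ , π , unique = reach⇒simple-path u⇝w in acyclic (simple-detour⇒cycle u–w π unique)

  sameRegion⇒reach-minus-bridge : ∀ {u w a b} → Bridge G u w → SameRegion G a b → Reach (EdgeMinus G u w) a b
  sameRegion⇒reach-minus-bridge {u} {w} uw = reach-map not-uw
    where
    not-uw : ∀ {a b} → Edge G a b × ¬ Bridge G a b → EdgeMinus G u w a b
    not-uw (e , ¬bridge) = e , (λ { (refl , refl) → ¬bridge uw }) , (λ { (refl , refl) → ¬bridge (bridge-sym uw) })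

  treeStepMinusEdge⇒reach : ∀ {u w a b} → Bridge G u w →
                            Reach (TreeStepMinusEdge G u w) a b → Reach (EdgeMinus G u w) a b
  treeStepMinusEdge⇒reach {u} {w} uw = reach-concatMap step⇒reach
    where
    step⇒reach : ∀ {a b} → TreeStepMinusEdge G u w a b → Reach (EdgeMinus G u w) a b
    step⇒reach (inj₁ a~b) = sameRegion⇒reach-minus-bridge uw a~b
    step⇒reach (inj₂ (_ , _ , a~p , (p–q , _) , q~b , ≢uw , ≢wu)) =
      reach-trans (sameRegion⇒reach-minus-bridge uw a~p) (step (p–q , ≢uw , ≢wu) (sameRegion⇒reach-minus-bridge uw q~b))

  module _ (bridge? : Decidable (Bridge G)) where

    edge⇒treeStep : ∀ {a b} → Edge G a b → TreeStep G a b
    edge⇒treeStep {a} {b} e with bridge? a b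
    ... | yes ab = inj₂ (a , b , here , ab , here)
    ... | no ¬ab = inj₁ (step (e , ¬ab) here)

    module _ {c : Fin n} (atomic : AtomicRegion G c) where

      atomic-edge⇒bridge : ∀ {p} → Edge G c p → Bridge G c p
      atomic-edge⇒bridge {p} c–p with bridge? c p
      ... | yes cp = cp
      ... | no ¬cp with atomic p (step (c–p , ¬cp) here)
      ...   | refl = ⊥-elim (irrfl G c c–p)

      reach-avoiding⇒treeStepMinusRegion : ∀ {a b} → Reach (Avoiding c (Edge G)) a b → Reach (TreeStepMinusRegion G c) a b
      reach-avoiding⇒treeStepMinusRegion = reach-map λ (e , a≢c , b≢c) →
        edge⇒treeStep e , a≢c ∘ atomic _ , b≢c ∘ atomic _

module _ (G : Graph n) (connected : Connected G) (bridge? : Decidable (Bridge G))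
         {c : Fin n} (atomic : AtomicRegion G c) (center : VertexCenter G c) where

  heavy-beyond-neighbour⇒edgeCenter : ∀ {p} → Edge G c p → (D : Subset n) →
                                      (∀ y → y ∈ D → Reach (Avoiding c (Edge G)) p y) →
                                      ∣ ∁ D ∣ ≤ ∣ D ∣ → EdgeCenter G c p
  heavy-beyond-neighbour⇒edgeCenter {p} c–p D D-reachable heavy = cp , light
    where
    cp : Bridge G c p
    cp = atomic-edge⇒bridge G bridge? atomic c–p

    avoiding⇒minus : ∀ {a b} → Avoiding c (Edge G) a b → EdgeMinus G c p a b
    avoiding⇒minus (e , a≢c , b≢c) = e , a≢c ∘ proj₁ , b≢c ∘ proj₂

    p↛c : ¬ Reach (EdgeMinus G c p) p c
    p↛c p⇝c = bridge-sides-disjoint G cp here p⇝c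

    p-side⇒avoiding : ∀ {y} → Reach (EdgeMinus G c p) p y → Reach (Avoiding c (Edge G)) p y
    p-side⇒avoiding p⇝y = reach-map (λ ((e , _) , a≢c , b≢c) → e , a≢c , b≢c) (reach-avoiding p⇝y p↛c)

    p-outside-region : ¬ SameRegion G c p
    p-outside-region c~p = irrfl G c (subst (Edge G c) (atomic p c~p) c–p)

    light : ∀ x → LightComponent (TreeStepMinusEdge G c p) x
    light x T T-reachable with reach-split G (connected x c)
    ... | inj₁ c⇝x = ⊆∁-heavy⇒light T D T⊆∁D heavy
      where
      T⊆∁D : T ⊆ ∁ D
      T⊆∁D {y} y∈T = x∉p⇒x∈∁p λ y∈D →
        bridge-sides-disjoint G cp
          (reach-trans c⇝x (treeStepMinusEdge⇒reach G cp (T-reachable y y∈T)))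
          (reach-map avoiding⇒minus (D-reachable y y∈D))
    ... | inj₂ p⇝x = center p p-outside-region T λ y y∈T →
      reach-avoiding⇒treeStepMinusRegion G bridge? atomic
        (p-side⇒avoiding (reach-trans p⇝x (treeStepMinusEdge⇒reach G cp (T-reachable y y∈T))))

  neighbour-toward : ∀ {r} → r ≢ c → ∃[ p ] Edge G c p × Reach (Avoiding c (Edge G)) p r
  neighbour-toward {r} r≢c with last-exit r≢c (connected c r)
  ... | inj₁ (c≢c , _) = ⊥-elim (c≢c refl)
  ... | inj₂ exit      = exit

  heavy-component⇒hasEdgeCenter : ∀ {H r} → (∀ {a b} → H a b → Edge G a b) → (D : Subset n) →
                                  IsComponent H r D → c ∉ D → ∣ ∁ D ∣ ≤ ∣ D ∣ → HasEdgeCenter G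
  heavy-component⇒hasEdgeCenter {H} {r} H⊆G D (D⊆component , component⊆D) c∉D heavy =
    let p , c–p , p⇝r = neighbour-toward r≢c
    in c , p , heavy-beyond-neighbour⇒edgeCenter c–p D (λ y y∈D → reach-trans p⇝r (r⇝y y∈D)) heavy
    where
    r↛c : ¬ Reach H r c
    r↛c = c∉D ∘ component⊆D c

    r≢c : r ≢ c
    r≢c refl = r↛c here

    r⇝y : ∀ {y} → y ∈ D → Reach (Avoiding c (Edge G)) r y
    r⇝y y∈D = reach-map (λ (e , a≢c , b≢c) → H⊆G e , a≢c , b≢c) (reach-avoiding (D⊆component _ y∈D) r↛c)

lemma3p6 : (n : ℕ) (G : Graph n) → Connected G
         → ¬ HasEdgeCenter G → HasAtomicVertexCenter G
         → (S : Graph n) → IsSpanningTree G S → ¬ ZeroSplittable S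
lemma3p6 n G connected noEdgeCenter (c , atomic , center) S (S⊆G , S-connected , S-acyclic)
         (u , w , u–w , A , B , A⊆u , u⊆A , B⊆w , w⊆B , ∣A∣≡∣B∣) =
  ¬¬-decidable (Bridge G) λ bridge? → noEdgeCenter (heavy-side bridge?)
  where
  A∪B : ∀ y → y ∈ A ⊎ y ∈ B
  A∪B y = Sum.map (u⊆A y) (w⊆B y) (reach-split S (S-connected y u))

  S-uw⊆G : ∀ {a b} → EdgeMinus S u w a b → Edge G a b
  S-uw⊆G (e , _) = S⊆G _ _ e

  heavy-side : Decidable (Bridge G) → HasEdgeCenter G
  heavy-side bridge? with c ∈? A | c ∈? B
  ... | yes c∈A | yes c∈B =
    ⊥-elim (bridge-sides-disjoint S (acyclic-edge⇒bridge S S-acyclic u–w) (A⊆u c c∈A) (B⊆w c c∈B))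
  ... | no c∉A | _ = heavy-component⇒hasEdgeCenter G connected bridge? atomic center S-uw⊆G A
    (A⊆u , u⊆A) c∉A (equal-cover⇒∣∁p∣≤∣p∣ A B A∪B ∣A∣≡∣B∣)
  ... | yes _ | no c∉B = heavy-component⇒hasEdgeCenter G connected bridge? atomic center S-uw⊆G B
    (B⊆w , w⊆B) c∉B (equal-cover⇒∣∁p∣≤∣p∣ B A (Sum.swap ∘ A∪B) (≡-sym ∣A∣≡∣B∣))
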